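{- Let $G=(V,E)$ be a finite simple undirected graph with $V=\{1,\dots,n\}$. For $i,j\in V$ let $a_{ij}=1$ if $i=j$ or $d(i,j)=2$, and $a_{ij}=0$ otherwise; and let $c_{ij}=-1$ if $i=j$, $c_{ij}=1$ if $d(i,j)=2$, and $c_{ij}=0$ otherwise. Then the optimal value of the integer program $$\min \sum_{i=1}^n x_i \ \text{ s.t. }\ \sum_{j=1,\,j\ne i}^n a_{ij}x_j\ge 1,\ \ \sum_{j=1}^n c_{ij}x_j<\deg_{\mathrm{Dist}(G;2)}(i),\ \ x_i\in\{0,1\}\quad(\forall i\in V)$$ equals the total 2-step restrained domination number $\gamma_{t2sr}(G)$.
   Context: $d(u,v)$ is the distance in $G$. $\mathrm{Dist}(G;2)$ is the graph with vertex set $V$ and edge set $\{uv: d_G(u,v)=2\}$. A set $S\subseteq V$ is a 2-step dominating set if for every $i\in V$ there is $j\in S$ with $d(i,j)=2$. A 2-step dominating set $S$ is a total 2-step restrained dominating set if for every $u\in V\setminus S$ there exists $v\in V\setminus S$ with $d(u,v)=2$. $\gamma_{t2sr}(G)$ is the minimum cardinality of a total 2-step restrained dominating set of $G$. -}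

module Defs where

open import Data.Nat using (ℕ; zero; suc)
open import Data.Integer using (ℤ; +_; -_; _+_; _*_; _≤_; _<_; 0ℤ; 1ℤ)
open import Data.Fin using (Fin; zero; suc; _≟_)
open import Data.Fin.Properties using (any?)
open import Data.Fin.Subset using (Subset; _∈_; _∉_; ∣_∣)
open import Data.Product using (Σ; ∃; _×_; _,_)
open import Data.Sum using (_⊎_)
open import Data.Bool using (if_then_else_)
open import Relation.Nullary using (¬_; Dec; does; ¬?; _×-dec_)
open import Relation.Binary.PropositionalEquality using (_≡_; _≢_)

record Graph (n : ℕ) : Set₁ where
  field
    Adj    : Fin n → Fin n → Set
    adj?   : (i j : Fin n) → Dec (Adj i j)
    sym    : ∀ {i j} → Adj i j → Adj j i
    irrefl : ∀ {i} → ¬ Adj i i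

module _ {n : ℕ} (G : Graph n) where
  open Graph G

  Dist2 : Fin n → Fin n → Set
  Dist2 i j = (i ≢ j) × (¬ Adj i j) × (∃ λ k → Adj i k × Adj k j)

  dist2? : (i j : Fin n) → Dec (Dist2 i j)
  dist2? i j = ¬? (i ≟ j) ×-dec (¬? (adj? i j) ×-dec any? (λ k → adj? i k ×-dec adj? k j))

Σᶠ : ∀ {n} → (Fin n → ℤ) → ℤ
Σᶠ {zero}  f = 0ℤ
Σᶠ {suc n} f = f zero + Σᶠ (λ i → f (suc i))

module _ {n : ℕ} (G : Graph n) where

  deg2 : Fin n → ℤ
  deg2 i = Σᶠ (λ j → if does (dist2? G i j) then 1ℤ else 0ℤ)

  aCoef : Fin n → Fin n → ℤ
  aCoef i j = if does (i ≟ j) then 1ℤ else (if does (dist2? G i j) then 1ℤ else 0ℤ)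

  cCoef : Fin n → Fin n → ℤ
  cCoef i j = if does (i ≟ j) then - 1ℤ else (if does (dist2? G i j) then 1ℤ else 0ℤ)

  Feasible : (Fin n → ℤ) → Set
  Feasible x =
    (∀ i → (x i ≡ 0ℤ) ⊎ (x i ≡ 1ℤ)) ×
    (∀ i → 1ℤ ≤ Σᶠ (λ j → if does (j ≟ i) then 0ℤ else aCoef i j * x j)) ×
    (∀ i → Σᶠ (λ j → cCoef i j * x j) < deg2 i)

  IPOptimalValue : ℤ → Set
  IPOptimalValue v =
    (Σ (Fin n → ℤ) λ x → Feasible x × Σᶠ x ≡ v) ×
    (∀ x → Feasible x → v ≤ Σᶠ x)

  TwoStepDominating : Subset n → Set
  TwoStepDominating S = ∀ i → ∃ λ j → j ∈ S × Dist2 G i j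

  Total2StepRestrainedDominating : Subset n → Set
  Total2StepRestrainedDominating S =
    TwoStepDominating S × (∀ u → u ∉ S → ∃ λ v → v ∉ S × Dist2 G u v)

  IsGammaT2SR : ℕ → Set
  IsGammaT2SR k =
    (Σ (Subset n) λ S → Total2StepRestrainedDominating S × ∣ S ∣ ≡ k) ×
    (∀ S → Total2StepRestrainedDominating S → k Data.Nat.≤ ∣ S ∣)

-- A 0/1 vector x is the indicator of its support S. The first constraint at i
-- sums x over the vertices at distance 2 from i (the diagonal term is
-- excluded), so it says that some vertex of S is at distance 2 from i. For the
-- second, deg₂(i) − Σⱼ cᵢⱼ xⱼ = xᵢ + #{j ∉ S : d(i,j) = 2}, so it says that
-- i ∈ S or some vertex outside S is at distance 2 from i; for i ∉ S this is the
-- restraint condition. Hence feasible vectors are exactly the indicators of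
-- total 2-step restrained dominating sets, and Σ x = |S|.
module Submission where

open import Defs
open import Data.Nat using (ℕ; zero; suc; z≤n; s≤s)
open import Data.Integer using (ℤ; +_; -_; _+_; _*_; _-_; _≤_; _<_; 0ℤ; 1ℤ; +≤+; +<+)
import Data.Integer as ℤ
import Data.Integer.Properties as ℤP
open import Data.Integer.Tactic.RingSolver using (solve-∀)
open import Algebra.Properties.CommutativeSemigroup ℤP.+-commutativeSemigroup using (interchange)
open import Data.Fin using (Fin; zero; suc; _≟_)
open import Data.Fin.Subset using (Subset; _∈_; _∉_; ∣_∣)
open import Data.Fin.Subset.Properties using (_∈?_)
open import Data.Vec using (_∷_; []; lookup; tabulate)
open import Data.Vec.Properties using (lookup∘tabulate; []=⇒lookup; lookup⇒[]=)
open import Data.Bool using (true; false; if_then_else_)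
open import Data.Product using (Σ; ∃; _×_; _,_; proj₁; proj₂; map₂; swap)
open import Data.Sum using (_⊎_; inj₁; inj₂)
open import Function using (_∘_)
open import Relation.Nullary using (¬_; Dec; yes; no; does; contradiction)
open import Relation.Binary.Definitions using (tri<; tri≈; tri>)
open import Relation.Binary.PropositionalEquality using (_≡_; _≢_; refl; sym; trans; cong; cong₂; subst; subst₂)
open import Function.Bundles using (_⇔_; mk⇔; Equivalence)

open Equivalence using (to; from)

Indicates : Set → ℤ → Set
Indicates P v = (P × v ≡ 1ℤ) ⊎ (¬ P × v ≡ 0ℤ)

Indicates⇒0≤ : ∀ {P v} → Indicates P v → 0ℤ ≤ v
Indicates⇒0≤ (inj₁ (_ , refl)) = +≤+ z≤n
Indicates⇒0≤ (inj₂ (_ , refl)) = +≤+ z≤n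

⟦_⟧ : ∀ {P : Set} → Dec P → ℤ
⟦ p ⟧ = if does p then 1ℤ else 0ℤ

⟦⟧-indicates : ∀ {P : Set} (p : Dec P) → Indicates P ⟦ p ⟧
⟦⟧-indicates (yes p) = inj₁ (p , refl)
⟦⟧-indicates (no ¬p) = inj₂ (¬p , refl)

⟦⟧-false : ∀ {P : Set} (p : Dec P) → ¬ P → ⟦ p ⟧ ≡ 0ℤ
⟦⟧-false (yes p) ¬p = contradiction p ¬p
⟦⟧-false (no _)  _  = refl

Indicates-* : ∀ {P Q u v} → Indicates P u → Indicates Q v → Indicates (P × Q) (u * v)
Indicates-* (inj₁ (p , refl)) (inj₁ (q , refl)) = inj₁ ((p , q) , refl)
Indicates-* (inj₁ (_ , refl)) (inj₂ (¬q , refl)) = inj₂ ((¬q ∘ proj₂) , refl)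
Indicates-* (inj₂ (¬p , refl)) _                 = inj₂ ((¬p ∘ proj₁) , refl)

Indicates-¬ : ∀ {P v} → Indicates P v → Indicates (¬ P) (1ℤ - v)
Indicates-¬ (inj₁ (p , refl))  = inj₂ ((λ ¬p → ¬p p) , refl)
Indicates-¬ (inj₂ (¬p , refl)) = inj₁ (¬p , refl)

Indicates-⇔ : ∀ {P P′ v} → P ⇔ P′ → Indicates P v → Indicates P′ v
Indicates-⇔ P⇔P′ (inj₁ (p , v≡1))  = inj₁ (to P⇔P′ p , v≡1)
Indicates-⇔ P⇔P′ (inj₂ (¬p , v≡0)) = inj₂ ((¬p ∘ from P⇔P′) , v≡0)

0<⇔1≤ : ∀ {s} → 0ℤ < s ⇔ 1ℤ ≤ s
0<⇔1≤ = mk⇔ ℤP.i<j⇒suc[i]≤j ℤP.suc[i]≤j⇒i<j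

i<i+j⇔0<j : ∀ i j → i < i + j ⇔ 0ℤ < j
i<i+j⇔0<j i j = mk⇔ cancel grow
  where
  cancel : i < i + j → 0ℤ < j
  cancel i<i+j with ℤP.<-cmp 0ℤ j
  ... | tri< 0<j _ _ = 0<j
  ... | tri≈ _ refl _ = contradiction (subst (i <_) (ℤP.+-identityʳ i) i<i+j) ℤP.i≮i
  ... | tri> _ _ j<0 =
    contradiction (subst (i <_) (ℤP.+-identityʳ i) (ℤP.<-trans i<i+j (ℤP.+-monoʳ-< i j<0))) ℤP.i≮i
  grow : 0ℤ < j → i < i + j
  grow 0<j = subst (_< i + j) (ℤP.+-identityʳ i) (ℤP.+-monoʳ-< i 0<j)

a≡b+[a-b] : ∀ a b → a ≡ b + (a - b)
a≡b+[a-b] = solve-∀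

0-[-1*v]≡v : ∀ v → 0ℤ - (- 1ℤ) * v ≡ v
0-[-1*v]≡v = solve-∀

d-d*v≡d*[1-v] : ∀ d v → d - d * v ≡ d * (1ℤ - v)
d-d*v≡d*[1-v] = solve-∀

Σᶠ-cong : ∀ {n} {f g : Fin n → ℤ} → (∀ j → f j ≡ g j) → Σᶠ f ≡ Σᶠ g
Σᶠ-cong {zero}  f≗g = refl
Σᶠ-cong {suc n} f≗g = cong₂ _+_ (f≗g zero) (Σᶠ-cong (f≗g ∘ suc))

Σᶠ-distrib-+ : ∀ {n} (f g : Fin n → ℤ) → Σᶠ (λ j → f j + g j) ≡ Σᶠ f + Σᶠ g
Σᶠ-distrib-+ {zero}  f g = refl
Σᶠ-distrib-+ {suc n} f g =
  trans (cong (_+_ (f zero + g zero)) (Σᶠ-distrib-+ (f ∘ suc) (g ∘ suc)))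
        (interchange (f zero) (g zero) (Σᶠ (f ∘ suc)) (Σᶠ (g ∘ suc)))

Σᶠ-nonneg : ∀ {n} {f : Fin n → ℤ} → (∀ j → 0ℤ ≤ f j) → 0ℤ ≤ Σᶠ f
Σᶠ-nonneg {zero}  0≤f = ℤP.≤-refl
Σᶠ-nonneg {suc n} 0≤f = ℤP.+-mono-≤ (0≤f zero) (Σᶠ-nonneg (0≤f ∘ suc))

Σᶠ-pos⇔∃ : ∀ {n} {P : Fin n → Set} {f : Fin n → ℤ} →
           (∀ j → Indicates (P j) (f j)) → 0ℤ < Σᶠ f ⇔ ∃ P
Σᶠ-pos⇔∃ indicates = mk⇔ (witness indicates) (positive indicates)
  where
  witness : ∀ {n} {P : Fin n → Set} {f : Fin n → ℤ} →
            (∀ j → Indicates (P j) (f j)) → 0ℤ < Σᶠ f → ∃ P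
  witness {zero} indicates (+<+ ())
  witness {suc n} {f = f} indicates 0<Σf with indicates zero
  ... | inj₁ (p , _) = zero , p
  ... | inj₂ (_ , f₀≡0) =
    let (j , p) = witness (indicates ∘ suc)
                    (subst (0ℤ <_) (trans (cong (_+ Σᶠ (f ∘ suc)) f₀≡0) (ℤP.+-identityˡ _)) 0<Σf)
    in suc j , p
  positive : ∀ {n} {P : Fin n → Set} {f : Fin n → ℤ} →
             (∀ j → Indicates (P j) (f j)) → ∃ P → 0ℤ < Σᶠ f
  positive {suc n} {f = f} indicates (zero , p) with indicates zero
  ... | inj₁ (_ , f₀≡1) = subst (λ f₀ → 0ℤ < f₀ + Σᶠ (f ∘ suc)) (sym f₀≡1)
    (ℤP.+-mono-<-≤ (+<+ (s≤s z≤n)) (Σᶠ-nonneg (Indicates⇒0≤ ∘ indicates ∘ suc)))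
  ... | inj₂ (¬p , _) = contradiction p ¬p
  positive {suc n} indicates (suc j , p) =
    ℤP.+-mono-≤-< (Indicates⇒0≤ (indicates zero)) (positive (indicates ∘ suc) (j , p))

χ : ∀ {n} → Subset n → Fin n → ℤ
χ S j = if lookup S j then 1ℤ else 0ℤ

χ-indicates : ∀ {n} (S : Subset n) j → Indicates (j ∈ S) (χ S j)
χ-indicates S j with lookup S j in eq
... | true  = inj₁ (lookup⇒[]= j S eq , refl)
... | false = inj₂ ((λ j∈S → contradiction (trans (sym ([]=⇒lookup j∈S)) eq) λ ()) , refl)

χ-isBit : ∀ {n} (S : Subset n) j → (χ S j ≡ 0ℤ) ⊎ (χ S j ≡ 1ℤ)
χ-isBit S j with lookup S j
... | true  = inj₂ refl
... | false = inj₁ refl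

Σᶠ-χ : ∀ {n} (S : Subset n) → Σᶠ (χ S) ≡ + ∣ S ∣
Σᶠ-χ []          = refl
Σᶠ-χ (true  ∷ S) = cong (_+_ 1ℤ) (Σᶠ-χ S)
Σᶠ-χ (false ∷ S) = cong (_+_ 0ℤ) (Σᶠ-χ S)

support : ∀ {n} → (Fin n → ℤ) → Subset n
support x = tabulate (λ j → does (x j ℤ.≟ 1ℤ))

χ-support : ∀ {n} {x : Fin n → ℤ} → (∀ j → (x j ≡ 0ℤ) ⊎ (x j ≡ 1ℤ)) →
            ∀ j → χ (support x) j ≡ x j
χ-support {x = x} bits j
  rewrite lookup∘tabulate (λ j → does (x j ℤ.≟ 1ℤ)) j with x j | bits j
... | _ | inj₁ refl = refl
... | _ | inj₂ refl = refl

Σᶠ-support : ∀ {n} {x : Fin n → ℤ} → (∀ j → (x j ≡ 0ℤ) ⊎ (x j ≡ 1ℤ)) →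
             Σᶠ x ≡ + ∣ support x ∣
Σᶠ-support {x = x} bits = trans (Σᶠ-cong (sym ∘ χ-support bits)) (Σᶠ-χ (support x))

module _ {n : ℕ} (G : Graph n) where

  Dist2-irrefl : ∀ {i} → ¬ Dist2 G i i
  Dist2-irrefl (i≢i , _) = i≢i refl

  Feasible-cong : ∀ {x y : Fin n → ℤ} → (∀ j → x j ≡ y j) → Feasible G x → Feasible G y
  Feasible-cong {x} {y} x≗y (bits , dominated , restrained) =
    (λ i → subst (λ v → (v ≡ 0ℤ) ⊎ (v ≡ 1ℤ)) (x≗y i) (bits i)) ,
    (λ i → subst (1ℤ ≤_)
             (Σᶠ-cong λ j → cong (λ v → if does (j ≟ i) then 0ℤ else aCoef G i j * v) (x≗y j))
             (dominated i)) ,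
    (λ i → subst (_< deg2 G i) (Σᶠ-cong λ j → cong (cCoef G i j *_) (x≗y j)) (restrained i))

  aCoef-offDiagonal : ∀ {i j} → i ≢ j → aCoef G i j ≡ ⟦ dist2? G i j ⟧
  aCoef-offDiagonal {i} {j} i≢j with i ≟ j
  ... | yes i≡j = contradiction i≡j i≢j
  ... | no _    = refl

  domination-term : ∀ {Q : Set} i j {v} → Indicates Q v →
    Indicates (Dist2 G i j × Q) (if does (j ≟ i) then 0ℤ else aCoef G i j * v)
  domination-term {Q} i j {v} q with j ≟ i
  ... | yes refl = inj₂ ((Dist2-irrefl ∘ proj₁) , refl)
  ... | no j≢i   =
    subst (λ a → Indicates (Dist2 G i j × Q) (a * v)) (sym (aCoef-offDiagonal (j≢i ∘ sym)))
          (Indicates-* (⟦⟧-indicates (dist2? G i j)) q)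

  dominated⇔ : ∀ (S : Subset n) i →
    1ℤ ≤ Σᶠ (λ j → if does (j ≟ i) then 0ℤ else aCoef G i j * χ S j) ⇔
    ∃ λ j → j ∈ S × Dist2 G i j
  dominated⇔ S i = mk⇔
    (map₂ swap ∘ to indicated ∘ from 0<⇔1≤)
    (to 0<⇔1≤ ∘ from indicated ∘ map₂ swap)
    where indicated = Σᶠ-pos⇔∃ (λ j → domination-term i j (χ-indicates S j))

  cCoef-diagonal : ∀ i → cCoef G i i ≡ - 1ℤ
  cCoef-diagonal i with i ≟ i
  ... | yes _   = refl
  ... | no i≢i = contradiction refl i≢i

  cCoef-offDiagonal : ∀ {i j} → i ≢ j → cCoef G i j ≡ ⟦ dist2? G i j ⟧
  cCoef-offDiagonal {i} {j} i≢j with i ≟ j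
  ... | yes i≡j = contradiction i≡j i≢j
  ... | no _    = refl

  -- Summed over j these terms give the slack deg₂(i) − Σⱼ cᵢⱼ xⱼ of the second constraint.
  restraint-term : ∀ {Q : Set} i j {v} → Indicates Q v →
    Indicates ((i ≡ j × Q) ⊎ (Dist2 G i j × ¬ Q)) (⟦ dist2? G i j ⟧ - cCoef G i j * v)
  restraint-term i j {v} q = byDiagonal (i ≟ j)
    where
    byDiagonal : Dec (i ≡ j) → Indicates _ (⟦ dist2? G i j ⟧ - cCoef G i j * v)
    byDiagonal (yes refl) =
      subst (Indicates _)
            (sym (trans (cong₂ (λ d c → d - c * v) (⟦⟧-false (dist2? G i i) Dist2-irrefl)
                                                   (cCoef-diagonal i))
                        (0-[-1*v]≡v v)))
            (Indicates-⇔ (mk⇔ (inj₁ ∘ (refl ,_)) diagonal) q)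
      where
      diagonal : (i ≡ i × _) ⊎ (Dist2 G i i × _) → _
      diagonal (inj₁ (_ , q)) = q
      diagonal (inj₂ (d , _)) = contradiction d Dist2-irrefl
    byDiagonal (no i≢j) =
      subst (Indicates _)
            (sym (trans (cong (λ c → ⟦ dist2? G i j ⟧ - c * v) (cCoef-offDiagonal i≢j))
                        (d-d*v≡d*[1-v] ⟦ dist2? G i j ⟧ v)))
            (Indicates-⇔ (mk⇔ inj₂ offDiagonal)
                         (Indicates-* (⟦⟧-indicates (dist2? G i j)) (Indicates-¬ q)))
      where
      offDiagonal : (i ≡ j × _) ⊎ (Dist2 G i j × _) → Dist2 G i j × _
      offDiagonal (inj₁ (i≡j , _)) = contradiction i≡j i≢j
      offDiagonal (inj₂ r)         = r

  restrained⇔ : ∀ (S : Subset n) i →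
    Σᶠ (λ j → cCoef G i j * χ S j) < deg2 G i ⇔ (i ∈ S ⊎ ∃ λ j → j ∉ S × Dist2 G i j)
  restrained⇔ S i = mk⇔
    (reshape ∘ to indicated ∘ to (i<i+j⇔0<j Σcx (Σᶠ slack)) ∘ subst (Σcx <_) deg2-split)
    (subst (Σcx <_) (sym deg2-split) ∘ from (i<i+j⇔0<j Σcx (Σᶠ slack)) ∘ from indicated ∘ unshape)
    where
    Σcx : ℤ
    Σcx = Σᶠ (λ j → cCoef G i j * χ S j)

    slack : Fin n → ℤ
    slack j = ⟦ dist2? G i j ⟧ - cCoef G i j * χ S j

    deg2-split : deg2 G i ≡ Σcx + Σᶠ slack
    deg2-split = trans (Σᶠ-cong λ j → a≡b+[a-b] ⟦ dist2? G i j ⟧ (cCoef G i j * χ S j))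
                       (Σᶠ-distrib-+ (λ j → cCoef G i j * χ S j) slack)

    indicated = Σᶠ-pos⇔∃ (λ j → restraint-term i j (χ-indicates S j))

    reshape : (∃ λ j → (i ≡ j × j ∈ S) ⊎ (Dist2 G i j × j ∉ S)) →
              i ∈ S ⊎ ∃ λ j → j ∉ S × Dist2 G i j
    reshape (_ , inj₁ (refl , i∈S)) = inj₁ i∈S
    reshape (j , inj₂ (d , j∉S))    = inj₂ (j , j∉S , d)

    unshape : i ∈ S ⊎ (∃ λ j → j ∉ S × Dist2 G i j) →
              ∃ λ j → (i ≡ j × j ∈ S) ⊎ (Dist2 G i j × j ∉ S)
    unshape (inj₁ i∈S)            = i , inj₁ (refl , i∈S)
    unshape (inj₂ (j , j∉S , d)) = j , inj₂ (d , j∉S)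

  χ-feasible⇔ : ∀ (S : Subset n) → Feasible G (χ S) ⇔ Total2StepRestrainedDominating G S
  χ-feasible⇔ S = mk⇔
    (λ (_ , dominated , restrained) →
      (to (dominated⇔ S _) ∘ dominated) ,
      (λ u u∉S → restraint u∉S (to (restrained⇔ S u) (restrained u))))
    (λ (dominating , restraining) →
      χ-isBit S ,
      (from (dominated⇔ S _) ∘ dominating) ,
      (λ i → from (restrained⇔ S i) (member-or-restrained restraining i)))
    where
    restraint : ∀ {u} → u ∉ S → u ∈ S ⊎ (∃ λ v → v ∉ S × Dist2 G u v) →
                ∃ λ v → v ∉ S × Dist2 G u v
    restraint u∉S (inj₁ u∈S) = contradiction u∈S u∉S
    restraint u∉S (inj₂ r)   = r

    member-or-restrained : (∀ u → u ∉ S → ∃ λ v → v ∉ S × Dist2 G u v) →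
                           ∀ i → i ∈ S ⊎ (∃ λ v → v ∉ S × Dist2 G i v)
    member-or-restrained restraining i with i ∈? S
    ... | yes i∈S = inj₁ i∈S
    ... | no  i∉S = inj₂ (restraining i i∉S)

  support-t2sr : ∀ {x} → Feasible G x → Total2StepRestrainedDominating G (support x)
  support-t2sr F = to (χ-feasible⇔ _) (Feasible-cong (sym ∘ χ-support (proj₁ F)) F)

mainTheorem6 : ∀ {n : ℕ} (G : Graph n) (v : ℤ) →
    IPOptimalValue G v ⇔ Σ ℕ (λ k → (v ≡ + k) × IsGammaT2SR G k)
mainTheorem6 G v = mk⇔ ip⇒γ γ⇒ip
  where
  ip⇒γ : IPOptimalValue G v → Σ ℕ (λ k → (v ≡ + k) × IsGammaT2SR G k)
  ip⇒γ ((x , F , Σx≡v) , minimal) =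
    ∣ support x ∣ , v≡∣support∣ , (support x , support-t2sr G F , refl) ,
    λ S T → ℤP.drop‿+≤+
      (subst₂ _≤_ v≡∣support∣ (Σᶠ-χ S) (minimal (χ S) (from (χ-feasible⇔ G S) T)))
    where
    v≡∣support∣ : v ≡ + ∣ support x ∣
    v≡∣support∣ = trans (sym Σx≡v) (Σᶠ-support (proj₁ F))

  γ⇒ip : Σ ℕ (λ k → (v ≡ + k) × IsGammaT2SR G k) → IPOptimalValue G v
  γ⇒ip (k , refl , (S , T , refl) , minimal) =
    (χ S , from (χ-feasible⇔ G S) T , Σᶠ-χ S) ,
    λ x F → subst (+ ∣ S ∣ ≤_) (sym (Σᶠ-support (proj₁ F)))
                  (+≤+ (minimal (support x) (support-t2sr G F)))
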